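{- Let $G$ be a finite simple graph. If $G\times K_2$ is type I, then $G\times H$ is type I for every finite simple bipartite graph $H$.
   Context: All graphs are finite and simple. A total colouring of a graph is an assignment of colours to its vertices and edges such that any two adjacent vertices, any two incident edges (edges sharing an endpoint), and any vertex and an edge incident with it receive different colours. The total chromatic number $\chi''(G)$ is the minimum number of colours in a total colouring of $G$. A graph $G$ with maximum degree $\Delta(G)$ is type I if $\chi''(G)=\Delta(G)+1$. The direct product $G\times H$ has vertex set $V(G)\times V(H)$, with $(u,v)$ adjacent to $(u',v')$ if and only if $uu'\in E(G)$ and $vv'\in E(H)$. $K_2$ denotes the complete graph on two vertices. -}

module Defs where

open import Data.Bool using (Bool; true; false; T; not)
open import Data.Nat using (ℕ; suc; _+_; _*_; _⊔_; _≤_)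
open import Data.Fin using (Fin; remQuot)
open import Data.Fin.Properties using () renaming (_≟_ to _≟ᶠ_)
open import Data.Product using (Σ; _×_; _,_; proj₁; proj₂)
open import Data.Vec using (Vec; countᵇ; allFin; map; foldr)
open import Relation.Binary.PropositionalEquality using (_≡_; _≢_)
open import Relation.Nullary.Decidable using (⌊_⌋)

record Graph : Set where
  field
    order : ℕ
    adj   : Fin order → Fin order → Bool
    sym   : ∀ u v → adj u v ≡ adj v u
    irrefl : ∀ u → adj u u ≡ false

open Graph public

Adj : (G : Graph) → Fin (order G) → Fin (order G) → Set
Adj G u v = T (adj G u v)

-- degree of a vertex and maximum degree Δ(G) (0 for the graph with no vertices)
degree : (G : Graph) → Fin (order G) → ℕ
degree G v = countᵇ (adj G v) (allFin (order G))

maxDegree : Graph → ℕ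
maxDegree G = foldr (λ _ → ℕ) _⊔_ 0 (map (degree G) (allFin (order G)))

-- A total colouring of G with k colours: a colour for each vertex and a colour
-- for each edge (the edge colour function is given on ordered pairs and is
-- required to be symmetric on edges).
record TotalColouring (G : Graph) (k : ℕ) : Set where
  field
    vcol : Fin (order G) → Fin k
    ecol : (u v : Fin (order G)) → Adj G u v → Fin k
    ecol-sym : ∀ u v (e : Adj G u v) (e' : Adj G v u) → ecol u v e ≡ ecol v u e'
    adj-vertices : ∀ u v → Adj G u v → vcol u ≢ vcol v
    incident-edges : ∀ u v w (e : Adj G u v) (e' : Adj G u w) →
                     v ≢ w → ecol u v e ≢ ecol u w e'
    vertex-edge : ∀ u v (e : Adj G u v) → vcol u ≢ ecol u v e

IsTotalChromaticNumber : Graph → ℕ → Set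
IsTotalChromaticNumber G k =
  TotalColouring G k × (∀ j → TotalColouring G j → k ≤ j)

TypeI : Graph → Set
TypeI G = IsTotalChromaticNumber G (suc (maxDegree G))

Bipartite : Graph → Set
Bipartite G = Σ (Fin (order G) → Bool) λ f → ∀ u v → Adj G u v → f u ≢ f v

K₂ : Graph
K₂ = record
  { order = 2
  ; adj = λ u v → not ⌊ u ≟ᶠ v ⌋
  ; sym = sym'
  ; irrefl = irr }
  where
  open import Relation.Binary.PropositionalEquality using (refl)
  sym' : ∀ u v → not ⌊ u ≟ᶠ v ⌋ ≡ not ⌊ v ≟ᶠ u ⌋
  sym' Fin.zero Fin.zero = refl
  sym' Fin.zero (Fin.suc Fin.zero) = refl
  sym' (Fin.suc Fin.zero) Fin.zero = refl
  sym' (Fin.suc Fin.zero) (Fin.suc Fin.zero) = refl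
  irr : ∀ u → not ⌊ u ≟ᶠ u ⌋ ≡ false
  irr Fin.zero = refl
  irr (Fin.suc Fin.zero) = refl

-- the direct (tensor / categorical) product G × H on Fin (|G| * |H|),
-- vertex i corresponding to the pair remQuot i
_×ᴰ_ : Graph → Graph → Graph
G ×ᴰ H = record
  { order = order G * order H
  ; adj = λ i j → a (remQuot (order H) i) (remQuot (order H) j)
  ; sym = λ i j → s (remQuot (order H) i) (remQuot (order H) j)
  ; irrefl = λ i → r (remQuot (order H) i) }
  where
  open import Data.Bool using (_∧_)
  open import Relation.Binary.PropositionalEquality using (cong₂; refl)
  open import Data.Bool.Properties using (∧-zeroʳ)
  a : Fin (order G) × Fin (order H) → Fin (order G) × Fin (order H) → Bool
  a (u , v) (u' , v') = adj G u u' ∧ adj H v v'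
  s : ∀ p q → a p q ≡ a q p
  s (u , v) (u' , v') = cong₂ _∧_ (Graph.sym G u u') (Graph.sym H v v')
  r : ∀ p → a p p ≡ false
  r (u , v) rewrite irrefl H v = ∧-zeroʳ (adj G u u)

module Submission where

-- Write B = G ×ᴰ K₂ and X = G ×ᴰ H.  The lower bound χ''(X) ≥ Δ(X) + 1 holds in
-- every graph with a vertex, since a vertex and its edges need distinct colours.
-- For the upper bound, X maps homomorphically to B by folding H onto K₂ along
-- its bipartition, and to H by projection; together these maps separate the
-- vertices of X.  B and H are bipartite, so by Kőnig's theorem they have proper
-- edge colourings with Δ(B) and Δ(H) colours.  Combined with a total colouring
-- of B with Δ(B) + 1 colours these give a total colouring of X with
-- Δ(H)·Δ(B) + 1 colours (module Lift), and Δ(H)·Δ(B) ≤ Δ(X) by comparing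
-- neighbourhoods in the products.

open import Defs hiding (sym)
open import Data.Bool using (Bool; true; false; T; not; if_then_else_; _xor_; _∧_)
open import Data.Bool.Properties using (T-∧; xor-same)
open import Data.Empty using (⊥; ⊥-elim)
open import Data.Unit using (tt)
open import Data.Nat using (ℕ; zero; suc; _≤_; _<_; _+_; _*_; _⊔_; _≥_; z≤n; s≤s)
open import Data.Nat.Properties
  using (≤-trans; m≤m⊔n; m≤n⊔m; ⊔-sel; n≮0; 1+n≰n; m≤n⇒m<n∨m≡n; *-zeroʳ; *-comm; *-monoʳ-≤;
         module ≤-Reasoning)
open import Data.Fin using (Fin; zero; suc; toℕ; fromℕ<; remQuot; combine; inject≤; _↑ˡ_; _↑ʳ_; splitAt)
open import Data.Fin.Properties
  using (suc-injective; toℕ-injective; toℕ≤pred[n]; toℕ-fromℕ<; inject≤-injective; injective⇒≤;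
         ↑ˡ-injective; ↑ʳ-injective; splitAt-↑ˡ; splitAt-↑ʳ; combine-injective; combine-remQuot;
         remQuot-combine; any?; all?; ¬∀⟶∃¬)
  renaming (_≟_ to _≟ᶠ_)
import Data.Product
open import Data.Product using (Σ; ∃; _×_; _,_; proj₁; proj₂; uncurry)
import Data.Sum
open import Data.Sum using (_⊎_; inj₁; inj₂; swap)
open import Data.Maybe as Maybe using (Maybe; just; nothing; _>>=_)
open import Data.Maybe.Properties using (just-injective; ≡-dec; map-injective)
open import Data.Fin.Permutation.Components using (transpose; transpose-inverse)
open import Data.List as List using (List; []; _∷_; cartesianProduct)
open import Data.List.Membership.Propositional using (_∈_)
open import Data.List.Membership.Propositional.Properties using (∈-cartesianProduct⁺; ∈-allFin)
open import Data.List.Relation.Unary.Any using (here; there)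
open import Data.Vec using (Vec; []; _∷_; lookup; tabulate; allFin; map; foldr; countᵇ)
open import Data.Vec.Properties using (lookup-map; lookup-allFin)
open import Function using (_∘_; id; Injective; Equivalence)
open import Relation.Nullary using (Dec; yes; no; ¬_)
open import Relation.Nullary.Decidable using (map′; dec-true; dec-false; T?; _×-dec_; _⊎-dec_)
open import Relation.Binary.Definitions using (DecidableEquality)
open import Relation.Binary.PropositionalEquality
  using (_≡_; _≢_; refl; sym; trans; cong; cong₂; subst; subst₂)

count : ∀ n → (Fin n → Bool) → ℕ
count zero    P = 0
count (suc n) P = (if P zero then suc else id) (count n (P ∘ suc))

countᵇ-tabulate : ∀ {n} {A : Set} (P : A → Bool) (f : Fin n → A) →
                  countᵇ P (tabulate f) ≡ count n (P ∘ f)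
countᵇ-tabulate {zero}  P f = refl
countᵇ-tabulate {suc n} P f = cong (if P (f zero) then suc else id) (countᵇ-tabulate P (f ∘ suc))

rank : ∀ {n} (P : Fin n → Bool) (i : Fin n) → T (P i) → Fin (count n P)
rank P zero p with P zero
... | true = zero
rank P (suc i) p with P zero
... | true  = suc (rank (P ∘ suc) i p)
... | false = rank (P ∘ suc) i p

rank-injective : ∀ {n} (P : Fin n → Bool) {i j} (p : T (P i)) (q : T (P j)) →
                 rank P i p ≡ rank P j q → i ≡ j
rank-injective P {zero}  {zero}  p q eq = refl
rank-injective P {zero}  {suc j} p q eq with P zero
rank-injective P {zero}  {suc j} p q () | true
rank-injective P {suc i} {zero}  p q eq with P zero
rank-injective P {suc i} {zero}  p q () | true
rank-injective P {suc i} {suc j} p q eq with P zero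
... | true  = cong suc (rank-injective (P ∘ suc) p q (suc-injective eq))
... | false = cong suc (rank-injective (P ∘ suc) p q eq)

enumerate : ∀ {n} (P : Fin n → Bool) → Fin (count n P) → Fin n
enumerate {suc n} P i with P zero
enumerate {suc n} P zero    | true = zero
enumerate {suc n} P (suc i) | true = suc (enumerate (P ∘ suc) i)
... | false = suc (enumerate (P ∘ suc) i)

enumerate-sound : ∀ {n} (P : Fin n → Bool) i → T (P (enumerate P i))
enumerate-sound {suc n} P i with P zero in eq
enumerate-sound {suc n} P zero    | true = subst T (sym eq) tt
enumerate-sound {suc n} P (suc i) | true = enumerate-sound (P ∘ suc) i
... | false = enumerate-sound (P ∘ suc) i

enumerate-injective : ∀ {n} (P : Fin n → Bool) → Injective _≡_ _≡_ (enumerate P)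
enumerate-injective {suc n} P {i} {j} eq with P zero
enumerate-injective {suc n} P {zero}  {zero}  eq | true = refl
enumerate-injective {suc n} P {suc i} {suc j} eq | true =
  cong suc (enumerate-injective (P ∘ suc) (suc-injective eq))
... | false = enumerate-injective (P ∘ suc) (suc-injective eq)

count-lower-bound : ∀ {n k} (P : Fin n → Bool) (f : Fin k → Fin n) → Injective _≡_ _≡_ f →
                    (∀ i → T (P (f i))) → k ≤ count n P
count-lower-bound P f f-injective Pf =
  injective⇒≤ (λ {i} {j} eq → f-injective (rank-injective P (Pf i) (Pf j) eq))

count-mono : ∀ {m n} (P : Fin m → Bool) (Q : Fin n → Bool) (f : Fin m → Fin n) →
             (∀ i → T (P i) → T (Q (f i))) →
             (∀ {i j} → T (P i) → T (P j) → f i ≡ f j → i ≡ j) →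
             count m P ≤ count n Q
count-mono P Q f P⇒Q f-injective =
  count-lower-bound Q (f ∘ enumerate P)
    (λ eq → enumerate-injective P (f-injective (enumerate-sound P _) (enumerate-sound P _) eq))
    (λ i → P⇒Q _ (enumerate-sound P i))

remQuot-injective : ∀ {m} n {i j : Fin (m * n)} → remQuot {m} n i ≡ remQuot n j → i ≡ j
remQuot-injective {m} n {i} {j} eq =
  trans (sym (combine-remQuot {m} n i)) (trans (cong (uncurry combine) eq) (combine-remQuot {m} n j))

count-product : ∀ {m n} (P : Fin m → Bool) (Q : Fin n → Bool) (R : Fin (m * n) → Bool) →
                (∀ i j → T (P i) → T (Q j) → T (R (combine i j))) →
                count m P * count n Q ≤ count (m * n) R
count-product {m} {n} P Q R PQ⇒R =
  count-lower-bound R pair pair-injective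
    (λ i → PQ⇒R _ _ (enumerate-sound P _) (enumerate-sound Q _))
  where
  pair : Fin (count m P * count n Q) → Fin (m * n)
  pair i = combine (enumerate P (proj₁ (remQuot {count m P} (count n Q) i)))
                   (enumerate Q (proj₂ (remQuot {count m P} (count n Q) i)))
  pair-injective : Injective _≡_ _≡_ pair
  pair-injective {i} {j} eq with combine-injective _ _ _ _ eq
  ... | eqP , eqQ = remQuot-injective {count m P} (count n Q)
                      (cong₂ _,_ (enumerate-injective P eqP) (enumerate-injective Q eqQ))

maximum : ∀ {n} → Vec ℕ n → ℕ
maximum = foldr (λ _ → ℕ) _⊔_ 0

lookup≤maximum : ∀ {n} (xs : Vec ℕ n) i → lookup xs i ≤ maximum xs
lookup≤maximum (x ∷ xs) zero    = m≤m⊔n x (maximum xs)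
lookup≤maximum (x ∷ xs) (suc i) = ≤-trans (lookup≤maximum xs i) (m≤n⊔m x (maximum xs))

maximum-attained : ∀ {n} (xs : Vec ℕ n) → maximum xs ≡ 0 ⊎ ∃ λ i → lookup xs i ≡ maximum xs
maximum-attained []       = inj₁ refl
maximum-attained (x ∷ xs) with ⊔-sel x (maximum xs)
... | inj₁ x⊔m≡x = inj₂ (zero , sym x⊔m≡x)
... | inj₂ x⊔m≡m with maximum-attained xs
...   | inj₁ m≡0          = inj₁ (trans x⊔m≡m m≡0)
...   | inj₂ (i , xsᵢ≡m)  = inj₂ (suc i , trans xsᵢ≡m (sym x⊔m≡m))

degree-count : ∀ G v → degree G v ≡ count (order G) (adj G v)
degree-count G v = countᵇ-tabulate (adj G v) id

lookup-degrees : ∀ G v → lookup (map (degree G) (allFin (order G))) v ≡ degree G v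
lookup-degrees G v = trans (lookup-map v (degree G) (allFin (order G))) (cong (degree G) (lookup-allFin v))

degree≤maxDegree : ∀ G v → degree G v ≤ maxDegree G
degree≤maxDegree G v =
  subst (_≤ maxDegree G) (lookup-degrees G v) (lookup≤maximum (map (degree G) (allFin (order G))) v)

maxDegree-attained : ∀ G → maxDegree G ≡ 0 ⊎ ∃ λ v → degree G v ≡ maxDegree G
maxDegree-attained G with maximum-attained (map (degree G) (allFin (order G)))
... | inj₁ Δ≡0      = inj₁ Δ≡0
... | inj₂ (v , eq) = inj₂ (v , trans (sym (lookup-degrees G v)) eq)

-- A vertex and its incident edges receive pairwise distinct colours,
-- so every total colouring uses at least degree w + 1 colours.
degree<colours : ∀ X {j} → TotalColouring X j → ∀ w → suc (degree X w) ≤ j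
degree<colours X {j} C w =
  subst (λ d → suc d ≤ j) (sym (degree-count X w)) (injective⇒≤ colours-injective)
  where
  open TotalColouring C
  N = adj X w
  colours : Fin (suc (count (order X) N)) → Fin j
  colours zero    = vcol w
  colours (suc i) = ecol w (enumerate N i) (enumerate-sound N i)
  colours-injective : Injective _≡_ _≡_ colours
  colours-injective {zero}  {zero}  _  = refl
  colours-injective {zero}  {suc i} eq = ⊥-elim (vertex-edge w _ _ eq)
  colours-injective {suc i} {zero}  eq = ⊥-elim (vertex-edge w _ _ (sym eq))
  colours-injective {suc i} {suc i′} eq with i ≟ᶠ i′
  ... | yes i≡i′ = cong suc i≡i′
  ... | no  i≢i′ = ⊥-elim (incident-edges w _ _ _ _ (i≢i′ ∘ enumerate-injective N) eq)

maxDegree<colours : ∀ X → Fin (order X) → ∀ {j} → TotalColouring X j → suc (maxDegree X) ≤ j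
maxDegree<colours X w₀ C with maxDegree-attained X
... | inj₁ Δ≡0     = subst (λ Δ → suc Δ ≤ _) (sym Δ≡0) (≤-trans (s≤s z≤n) (degree<colours X C w₀))
... | inj₂ (w , d) = subst (λ Δ → suc Δ ≤ _) d (degree<colours X C w)

empty-colouring : ∀ X → (Fin (order X) → ⊥) → TotalColouring X 0
empty-colouring X none = record
  { vcol           = λ x → ⊥-elim (none x)
  ; ecol           = λ x _ _ → ⊥-elim (none x)
  ; ecol-sym       = λ x _ _ _ → ⊥-elim (none x)
  ; adj-vertices   = λ x _ _ _ → none x
  ; incident-edges = λ x _ _ _ _ _ _ → none x
  ; vertex-edge    = λ x _ _ _ → none x }

-- A type I graph has a vertex: otherwise it would need no colours, not Δ + 1.
vertex-or-empty : ∀ n → Fin n ⊎ (Fin n → ⊥)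
vertex-or-empty zero    = inj₂ λ ()
vertex-or-empty (suc n) = inj₁ zero

typeI-vertex : ∀ X → TypeI X → Fin (order X)
typeI-vertex X (_ , minimal) with vertex-or-empty (order X)
... | inj₁ w    = w
... | inj₂ none = ⊥-elim (n≮0 (minimal 0 (empty-colouring X none)))

more-colours : ∀ X {a b} → a ≤ b → TotalColouring X a → TotalColouring X b
more-colours X {a} {b} a≤b C = record
  { vcol           = λ x → ι (vcol x)
  ; ecol           = λ x y e → ι (ecol x y e)
  ; ecol-sym       = λ x y e e′ → cong ι (ecol-sym x y e e′)
  ; adj-vertices   = λ x y e → adj-vertices x y e ∘ ι-injective
  ; incident-edges = λ x y z e e′ y≢z → incident-edges x y z e e′ y≢z ∘ ι-injective
  ; vertex-edge    = λ x y e → vertex-edge x y e ∘ ι-injective }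
  where
  open TotalColouring C
  ι : Fin a → Fin b
  ι i = inject≤ i a≤b
  ι-injective : ∀ {i j} → ι i ≡ ι j → i ≡ j
  ι-injective {i} {j} = inject≤-injective a≤b a≤b i j

transpose-injective : ∀ {n} (i j : Fin n) → Injective _≡_ _≡_ (transpose i j)
transpose-injective i j eq =
  trans (sym (transpose-inverse j i)) (trans (cong (transpose j i) eq) (transpose-inverse j i))

transpose-fix : ∀ {n} {i j x : Fin n} → x ≢ i → x ≢ j → transpose i j x ≡ x
transpose-fix {i = i} {j} {x} x≢i x≢j
  rewrite dec-false (x ≟ᶠ i) x≢i | dec-false (x ≟ᶠ j) x≢j = refl

transpose-j : ∀ {n} (i j : Fin n) → transpose i j j ≡ i
transpose-j i j with j ≟ᶠ i
... | yes j≡i = j≡i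
... | no _ rewrite dec-true (j ≟ᶠ j) refl = refl

transpose-to-i : ∀ {n} (i j : Fin n) {x} → transpose i j x ≡ i → x ≡ j
transpose-to-i i j eq =
  trans (sym (transpose-inverse j i)) (trans (cong (transpose j i) eq) (transpose-j j i))

record EdgeColouring (G : Graph) (k : ℕ) : Set where
  field
    colour     : ∀ u v → Adj G u v → Fin k
    colour-sym : ∀ u v (e : Adj G u v) (e′ : Adj G v u) → colour u v e ≡ colour v u e′
    proper     : ∀ u v w (e : Adj G u v) (e′ : Adj G u w) → v ≢ w → colour u v e ≢ colour u w e′

_≟ᴹ_ : ∀ {n} → DecidableEquality (Maybe (Fin n))
_≟ᴹ_ = ≡-dec _≟ᶠ_

-- Edges are coloured one at a time; when the
-- free colours α at u and β at v differ, the α/β alternating path starting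
-- at v (the Kempe chain) is recoloured by exchanging α and β, which frees α
-- at v while, by bipartiteness, the path never reaches u.
module Kőnig (X : Graph) (side : Fin (order X) → Bool)
             (bipartite : ∀ u v → Adj X u v → side u ≢ side v) where

  private
    V = Fin (order X)
    k = maxDegree X

  record PartialColouring : Set where
    field
      col        : V → V → Maybe (Fin k)
      col-sym    : ∀ u v → col u v ≡ col v u
      col-edge   : ∀ u v {γ} → col u v ≡ just γ → Adj X u v
      col-proper : ∀ u v w {γ} → col u v ≡ just γ → col u w ≡ just γ → v ≡ w
  open PartialColouring

  Coloured : PartialColouring → V → V → Set
  Coloured P u v = ∃ λ γ → col P u v ≡ just γ

  -- P′ colours (possibly differently) every pair coloured by P.
  _⊑_ : PartialColouring → PartialColouring → Set
  P ⊑ P′ = ∀ u v → Coloured P u v → Coloured P′ u v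

  ⊑-refl : ∀ {P} → P ⊑ P
  ⊑-refl _ _ c = c

  ⊑-trans : ∀ {P P′ P″} → P ⊑ P′ → P′ ⊑ P″ → P ⊑ P″
  ⊑-trans P⊑P′ P′⊑P″ u v = P′⊑P″ u v ∘ P⊑P′ u v

  Missing : PartialColouring → V → Fin k → Set
  Missing P u γ = ∀ w → col P u w ≢ just γ

  -- A vertex u with an uncoloured edge uv meets at most Δ - 1 coloured edges,
  -- so some colour is missing at u.
  missing-colour : ∀ P u v → Adj X u v → col P u v ≡ nothing → ∃ (Missing P u)
  missing-colour P u v uv uncoloured with all? (λ γ → any? (λ w → col P u w ≟ᴹ just γ))
  ... | no ¬all-used =
    let γ , unused = ¬∀⟶∃¬ k _ (λ γ → any? (λ w → col P u w ≟ᴹ just γ)) ¬all-used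
    in γ , λ w uw≡γ → unused (w , uw≡γ)
  ... | yes used = ⊥-elim (1+n≰n (≤-trans too-many-neighbours degree≤k))
    where
    degree≤k : count (order X) (adj X u) ≤ k
    degree≤k = subst (_≤ k) (degree-count X u) (degree≤maxDegree X u)
    -- v, followed by a neighbour of u along each of the k colours
    nbr : Fin (suc k) → V
    nbr zero    = v
    nbr (suc γ) = proj₁ (used γ)
    label : Fin (suc k) → Maybe (Fin k)
    label zero    = nothing
    label (suc γ) = just γ
    label-injective : Injective _≡_ _≡_ label
    label-injective {zero}  {zero}  _  = refl
    label-injective {suc γ} {suc δ} eq = cong suc (just-injective eq)
    nbr-label : ∀ i → col P u (nbr i) ≡ label i
    nbr-label zero    = uncoloured
    nbr-label (suc γ) = proj₂ (used γ)
    nbr-injective : Injective _≡_ _≡_ nbr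
    nbr-injective {i} {j} eq =
      label-injective (trans (sym (nbr-label i)) (trans (cong (col P u) eq) (nbr-label j)))
    nbr-adjacent : ∀ i → T (adj X u (nbr i))
    nbr-adjacent zero    = uv
    nbr-adjacent (suc γ) = col-edge P u _ (proj₂ (used γ))
    too-many-neighbours : suc k ≤ count (order X) (adj X u)
    too-many-neighbours = count-lower-bound (adj X u) nbr nbr-injective nbr-adjacent

  module KempeChain (P : PartialColouring) {u v : V} (uv : Adj X u v) {α β : Fin k}
                    (α-missing : Missing P u α) (β-missing : Missing P v β) where

    -- The chain leaves a vertex on v's side along α and enters it along β;
    -- on the other side the roles are exchanged.  parity x is true off v's side.
    parity : V → Bool
    parity x = side x xor side v

    leave enter : Bool → Fin k
    leave false = α
    leave true  = β
    enter false = β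
    enter true  = α

    outColour inColour : V → Fin k
    outColour x = leave (parity x)
    inColour  x = enter (parity x)

    parity-flips : ∀ {x y} → Adj X x y → parity y ≡ not (parity x)
    parity-flips {x} {y} xy = flip (side x) (side y) (side v) (bipartite x y xy)
      where
      flip : ∀ a b c → a ≢ b → b xor c ≡ not (a xor c)
      flip false false _ a≢b = ⊥-elim (a≢b refl)
      flip true  true  _ a≢b = ⊥-elim (a≢b refl)
      flip false true  false _ = refl
      flip false true  true  _ = refl
      flip true  false false _ = refl
      flip true  false true  _ = refl

    in-after-out : ∀ {x y} → Adj X x y → inColour y ≡ outColour x
    in-after-out {x} xy = trans (cong enter (parity-flips xy)) (enter-not (parity x))
      where
      enter-not : ∀ b → enter (not b) ≡ leave b
      enter-not false = refl
      enter-not true  = refl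

    out-or-in : ∀ x {γ} → γ ≡ α ⊎ γ ≡ β → γ ≡ outColour x ⊎ γ ≡ inColour x
    out-or-in x = by-parity (parity x)
      where
      by-parity : ∀ b {γ} → γ ≡ α ⊎ γ ≡ β → γ ≡ leave b ⊎ γ ≡ enter b
      by-parity false γ∈αβ = γ∈αβ
      by-parity true  γ∈αβ = swap γ∈αβ

    in-v : inColour v ≡ β
    in-v = cong enter (xor-same (side v))

    in-u : inColour u ≡ α
    in-u = cong enter (trans (parity-flips (subst T (Graph.sym X u v) uv)) (cong not (xor-same (side v))))

    neighbour : Fin k → V → Maybe V
    neighbour γ x with any? (λ y → col P x y ≟ᴹ just γ)
    ... | yes (y , _) = just y
    ... | no _        = nothing

    neighbour-sound : ∀ {γ x y} → neighbour γ x ≡ just y → col P x y ≡ just γ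
    neighbour-sound {γ} {x} eq with any? (λ y → col P x y ≟ᴹ just γ)
    neighbour-sound refl | yes (y , xy≡γ) = xy≡γ

    neighbour-complete : ∀ {γ x y} → col P x y ≡ just γ → neighbour γ x ≡ just y
    neighbour-complete {γ} {x} xy≡γ with any? (λ y → col P x y ≟ᴹ just γ)
    ... | yes (y′ , xy′≡γ) = cong just (col-proper P x y′ _ xy′≡γ xy≡γ)
    ... | no none          = ⊥-elim (none (_ , xy≡γ))

    next : V → Maybe V
    next x = neighbour (outColour x) x

    next-enters : ∀ {x y} → next x ≡ just y → col P y x ≡ just (inColour y)
    next-enters {x} {y} step =
      trans (col-sym P y x) (trans xy (cong just (sym (in-after-out (col-edge P x y xy)))))
      where
      xy : col P x y ≡ just (outColour x)
      xy = neighbour-sound step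

    next-injective : ∀ {x x′ y} → next x ≡ just y → next x′ ≡ just y → x ≡ x′
    next-injective step step′ = col-proper P _ _ _ (next-enters step) (next-enters step′)

    -- No chain edge enters v, since β is missing there.
    v-unentered : ∀ y → col P v y ≢ just (inColour v)
    v-unentered y vy = β-missing y (trans vy (cong just in-v))

    orbit : ℕ → Maybe V
    orbit zero    = just v
    orbit (suc t) = orbit t >>= next

    orbit-pred : ∀ t {y} → orbit (suc t) ≡ just y → ∃ λ x → orbit t ≡ just x × next x ≡ just y
    orbit-pred t eq with orbit t
    ... | just x = x , refl , eq

    orbit-injective : ∀ i j {x} → orbit i ≡ just x → orbit j ≡ just x → i ≡ j
    orbit-injective zero    zero    _    _  = refl
    orbit-injective zero    (suc j) refl oj =
      ⊥-elim (v-unentered _ (next-enters (proj₂ (proj₂ (orbit-pred j oj)))))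
    orbit-injective (suc i) zero    oi refl =
      ⊥-elim (v-unentered _ (next-enters (proj₂ (proj₂ (orbit-pred i oi)))))
    orbit-injective (suc i) (suc j) oi oj with orbit-pred i oi | orbit-pred j oj
    ... | x , ox , step | x′ , ox′ , step′ with next-injective step step′
    ... | refl = cong suc (orbit-injective i j ox ox′)

    orbit-earlier : ∀ t {x} i → i ≤ t → orbit t ≡ just x → ∃ λ y → orbit i ≡ just y
    orbit-earlier zero    zero  z≤n   ot = _ , ot
    orbit-earlier (suc t) i     i≤1+t ot with m≤n⇒m<n∨m≡n i≤1+t
    ... | inj₂ refl      = _ , ot
    ... | inj₁ (s≤s i≤t) = orbit-earlier t i i≤t (proj₁ (proj₂ (orbit-pred t ot)))

    -- Its t + 1 distinct vertices show that the chain is shorter than order X.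
    orbit-bounded : ∀ t {x} → orbit t ≡ just x → t < order X
    orbit-bounded t ot = injective⇒≤ visit-injective
      where
      visit : Fin (suc t) → V
      visit i = proj₁ (orbit-earlier t (toℕ i) (toℕ≤pred[n] i) ot)
      visit-injective : Injective _≡_ _≡_ visit
      visit-injective {i} {j} eq =
        toℕ-injective (orbit-injective _ _ (proj₂ (orbit-earlier t (toℕ i) (toℕ≤pred[n] i) ot))
          (trans (proj₂ (orbit-earlier t (toℕ j) (toℕ≤pred[n] j) ot)) (cong just (sym eq))))

    InChain : V → Set
    InChain x = ∃ λ t → orbit t ≡ just x

    inChain? : ∀ x → Dec (InChain x)
    inChain? x = map′ (λ (t , ot) → toℕ t , ot) bounded (any? (λ t → orbit (toℕ t) ≟ᴹ just x))
      where
      bounded : InChain x → ∃ λ (t : Fin (order X)) → orbit (toℕ t) ≡ just x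
      bounded (t , ot) = fromℕ< t<n , subst (λ s → orbit s ≡ just x) (sym (toℕ-fromℕ< t<n)) ot
        where t<n = orbit-bounded t ot

    v∈chain : InChain v
    v∈chain = zero , refl

    -- u is not on the chain: it would be entered along inColour u = α, missing at u.
    u∉chain : ¬ InChain u
    u∉chain (zero  , refl) = bipartite u u uv refl
    u∉chain (suc t , ot)   =
      let _ , _ , step = orbit-pred t ot in α-missing _ (trans (next-enters step) (cong just in-u))

    chain-out : ∀ {x y} → InChain x → col P x y ≡ just (outColour x) → InChain y
    chain-out (t , ot) xy = suc t , trans (cong (_>>= next) ot) (neighbour-complete xy)

    chain-in : ∀ {x y} → InChain x → col P x y ≡ just (inColour x) → InChain y
    chain-in (zero  , refl) vy = ⊥-elim (v-unentered _ vy)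
    chain-in (suc t , ot)   xy with orbit-pred t ot
    ... | z , oz , step with col-proper P _ _ _ xy (next-enters step)
    ... | refl = t , oz

    chain-closed : ∀ {x y γ} → InChain x → col P x y ≡ just γ → γ ≡ α ⊎ γ ≡ β → InChain y
    chain-closed {x} x∈ xy γ∈αβ with out-or-in x γ∈αβ
    ... | inj₁ refl = chain-out x∈ xy
    ... | inj₂ refl = chain-in x∈ xy

    σ : Fin k → Fin k
    σ = transpose α β

    swapOn : ∀ {x} → Dec (InChain x) → Maybe (Fin k) → Maybe (Fin k)
    swapOn (yes _) = Maybe.map σ
    swapOn (no _)  = id

    swapOn-injective : ∀ {x} (d : Dec (InChain x)) → Injective _≡_ _≡_ (swapOn d)
    swapOn-injective (yes _) = map-injective (transpose-injective α β)
    swapOn-injective (no _)  = id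

    swapOn-reflects : ∀ {x} (d : Dec (InChain x)) {m : Maybe (Fin k)} {γ} →
                      swapOn d m ≡ just γ → ∃ λ δ → m ≡ just δ
    swapOn-reflects (yes _) {just δ} _  = δ , refl
    swapOn-reflects (no _)           eq = _ , eq

    swapOn-preserves : ∀ {x} (d : Dec (InChain x)) {m : Maybe (Fin k)} {γ} →
                       m ≡ just γ → ∃ λ δ → swapOn d m ≡ just δ
    swapOn-preserves (yes _) refl = _ , refl
    swapOn-preserves (no _)  eq   = _ , eq

    -- An edge leaving the chain has a colour other than α and β, so σ fixes it.
    boundary-fixed : ∀ {x y} → InChain x → ¬ InChain y → Maybe.map σ (col P x y) ≡ col P x y
    boundary-fixed {x} {y} x∈ y∉ with col P x y in xy
    ... | nothing = refl
    ... | just γ  = cong just (transpose-fix (λ γ≡α → y∉ (chain-closed x∈ xy (inj₁ γ≡α)))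
                                             (λ γ≡β → y∉ (chain-closed x∈ xy (inj₂ γ≡β))))

    swapped : PartialColouring
    swapped = record
      { col        = λ x y → swapOn (inChain? x) (col P x y)
      ; col-sym    = λ x y → symmetric (inChain? x) (inChain? y)
      ; col-edge   = λ x y xy → col-edge P x y (proj₂ (swapOn-reflects (inChain? x) xy))
      ; col-proper = proper }
      where
      symmetric : ∀ {x y} (dx : Dec (InChain x)) (dy : Dec (InChain y)) →
                  swapOn dx (col P x y) ≡ swapOn dy (col P y x)
      symmetric {x} {y} (yes _)  (yes _)  = cong (Maybe.map σ) (col-sym P x y)
      symmetric {x} {y} (no _)   (no _)   = col-sym P x y
      symmetric {x} {y} (yes x∈) (no y∉)  = trans (boundary-fixed x∈ y∉) (col-sym P x y)
      symmetric {x} {y} (no x∉)  (yes y∈) = trans (col-sym P x y) (sym (boundary-fixed y∈ x∉))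
      proper : ∀ x y w {γ} → swapOn (inChain? x) (col P x y) ≡ just γ →
               swapOn (inChain? x) (col P x w) ≡ just γ → y ≡ w
      -- all colours at x are changed by the same injective map
      proper x y w xy xw =
        let _ , xyδ = swapOn-reflects (inChain? x) xy
        in col-proper P x y w xyδ (trans (swapOn-injective (inChain? x) (trans xw (sym xy))) xyδ)

    P⊑swapped : P ⊑ swapped
    P⊑swapped x y (_ , xy) = swapOn-preserves (inChain? x) xy

    -- u is off the chain, so nothing changes at u.
    swapped-at-u : ∀ w → col swapped u w ≡ col P u w
    swapped-at-u w with inChain? u
    ... | yes u∈ = ⊥-elim (u∉chain u∈)
    ... | no _   = refl

    swapped-missing-u : Missing swapped u α
    swapped-missing-u w uw = α-missing w (trans (sym (swapped-at-u w)) uw)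

    -- At v the α-edge (if any) became β, and β was missing, so α is now missing.
    swapped-missing-v : Missing swapped v α
    swapped-missing-v w vw with inChain? v | col P v w in vw′
    ... | no v∉  | _      = v∉ v∈chain
    ... | yes _  | just δ = β-missing w (trans vw′ (cong just (transpose-to-i α β (just-injective vw))))

  module ColourEdge (P : PartialColouring) {u v : V} (uv : Adj X u v)
                    {α : Fin k}
                    (α-missing-u : Missing P u α) (α-missing-v : Missing P v α) where

    IsUV : V → V → Set
    IsUV a b = (a ≡ u × b ≡ v) ⊎ (a ≡ v × b ≡ u)

    isUV? : ∀ a b → Dec (IsUV a b)
    isUV? a b = ((a ≟ᶠ u) ×-dec (b ≟ᶠ v)) ⊎-dec ((a ≟ᶠ v) ×-dec (b ≟ᶠ u))

    isUV-sym : ∀ {a b} → IsUV a b → IsUV b a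
    isUV-sym = swap ∘ Data.Sum.map Data.Product.swap Data.Product.swap

    u≢v : u ≢ v
    u≢v u≡v = bipartite u v uv (cong side u≡v)

    α-missing : ∀ {a b} → IsUV a b → Missing P a α
    α-missing (inj₁ (refl , _)) = α-missing-u
    α-missing (inj₂ (refl , _)) = α-missing-v

    extendOn : ∀ {a b} → Dec (IsUV a b) → Maybe (Fin k) → Maybe (Fin k)
    extendOn (yes _) _ = just α
    extendOn (no _)  m = m

    extended : PartialColouring
    extended = record
      { col        = λ a b → extendOn (isUV? a b) (col P a b)
      ; col-sym    = λ a b → symmetric (isUV? a b) (isUV? b a)
      ; col-edge   = λ a b → edge (isUV? a b)
      ; col-proper = λ a b w → proper (isUV? a b) (isUV? a w) }
      where
      symmetric : ∀ {a b} (d : Dec (IsUV a b)) (d′ : Dec (IsUV b a)) →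
                  extendOn d (col P a b) ≡ extendOn d′ (col P b a)
      symmetric         (yes _)   (yes _)   = refl
      symmetric         (yes ab)  (no ¬ba)  = ⊥-elim (¬ba (isUV-sym ab))
      symmetric         (no ¬ab)  (yes ba)  = ⊥-elim (¬ab (isUV-sym ba))
      symmetric {a} {b} (no _)    (no _)    = col-sym P a b
      edge : ∀ {a b γ} (d : Dec (IsUV a b)) → extendOn d (col P a b) ≡ just γ → Adj X a b
      edge         (yes (inj₁ (refl , refl))) _  = uv
      edge         (yes (inj₂ (refl , refl))) _  = subst T (Graph.sym X u v) uv
      edge {a} {b} (no _)                     ab = col-edge P a b ab
      proper : ∀ {a b w γ} (d : Dec (IsUV a b)) (d′ : Dec (IsUV a w)) →
               extendOn d (col P a b) ≡ just γ → extendOn d′ (col P a w) ≡ just γ → b ≡ w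
      proper (yes (inj₁ (refl , refl))) (yes (inj₁ (_ , refl))) _ _ = refl
      proper (yes (inj₂ (refl , refl))) (yes (inj₂ (_ , refl))) _ _ = refl
      proper (yes (inj₁ (refl , _)))    (yes (inj₂ (u≡v , _)))  _ _ = ⊥-elim (u≢v u≡v)
      proper (yes (inj₂ (refl , _)))    (yes (inj₁ (v≡u , _)))  _ _ = ⊥-elim (u≢v (sym v≡u))
      proper (yes ab) (no _)  refl aw   = ⊥-elim (α-missing ab _ aw)
      proper (no _)   (yes aw) ab refl  = ⊥-elim (α-missing aw _ ab)
      proper {a} {b} {w} (no _) (no _) ab aw = col-proper P a b w ab aw

    P⊑extended : P ⊑ extended
    P⊑extended a b (γ , ab) with isUV? a b
    ... | yes _ = α , refl
    ... | no _  = γ , ab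

    extended-uv : Coloured extended u v
    extended-uv with isUV? u v
    ... | yes _   = α , refl
    ... | no ¬uv  = ⊥-elim (¬uv (inj₁ (refl , refl)))

  colour-pair : ∀ P a b → Σ PartialColouring λ P′ → P ⊑ P′ × (Adj X a b → Coloured P′ a b)
  colour-pair P a b with col P a b in ab | T? (adj X a b)
  ... | just γ  | _        = P , ⊑-refl {P} , λ _ → γ , ab
  ... | nothing | no ¬edge = P , ⊑-refl {P} , ⊥-elim ∘ ¬edge
  ... | nothing | yes edge =
    extended , ⊑-trans {P} {swapped} {extended} P⊑swapped P⊑extended , λ _ → extended-uv
    where
    α-at-a = missing-colour P a b edge ab
    β-at-b = missing-colour P b a (subst T (Graph.sym X a b) edge) (trans (col-sym P b a) ab)
    open KempeChain P edge (proj₂ α-at-a) (proj₂ β-at-b)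
    open ColourEdge swapped edge swapped-missing-u swapped-missing-v

  colour-pairs : ∀ (ps : List (V × V)) P →
                 Σ PartialColouring λ P′ → P ⊑ P′ × (∀ {a b} → (a , b) ∈ ps → Adj X a b → Coloured P′ a b)
  colour-pairs []             P = P , ⊑-refl {P} , λ ()
  colour-pairs ((a , b) ∷ ps) P =
    let P₁ , P⊑P₁ , ab-coloured = colour-pair P a b
        P₂ , P₁⊑P₂ , ps-coloured = colour-pairs ps P₁
        covered : ∀ {a′ b′} → (a′ , b′) ∈ ((a , b) ∷ ps) → Adj X a′ b′ → Coloured P₂ a′ b′
        covered = λ { (here refl) e → P₁⊑P₂ a b (ab-coloured e) ; (there m) e → ps-coloured m e }
    in P₂ , ⊑-trans {P} {P₁} {P₂} P⊑P₁ P₁⊑P₂ , covered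

  blank : PartialColouring
  blank = record
    { col = λ _ _ → nothing ; col-sym = λ _ _ → refl ; col-edge = λ _ _ () ; col-proper = λ _ _ _ () }

  edgeColouring : EdgeColouring X k
  edgeColouring = record
    { colour     = colour
    ; colour-sym = λ u v e e′ →
        just-injective (trans (sym (final-col e)) (trans (col-sym final u v) (final-col e′)))
    ; proper     = λ u v w e e′ v≢w same →
        v≢w (col-proper final u v w (final-col e) (trans (final-col e′) (cong just (sym same)))) }
    where
    allPairs = cartesianProduct (List.allFin (order X)) (List.allFin (order X))
    final = proj₁ (colour-pairs allPairs blank)
    coloured : ∀ u v → Adj X u v → Coloured final u v
    coloured u v = proj₂ (proj₂ (colour-pairs allPairs blank))
                         (∈-cartesianProduct⁺ (∈-allFin u) (∈-allFin v))
    colour : ∀ u v → Adj X u v → Fin k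
    colour u v e = proj₁ (coloured u v e)
    final-col : ∀ {u v} (e : Adj X u v) → col final u v ≡ just (colour u v e)
    final-col {u} {v} e = proj₂ (coloured u v e)

kőnig : ∀ X → Bipartite X → EdgeColouring X (maxDegree X)
kőnig X (side , bipartite) = Kőnig.edgeColouring X side bipartite

record Homomorphism (X Y : Graph) : Set where
  field
    vmap      : Fin (order X) → Fin (order Y)
    preserves : ∀ {u v} → Adj X u v → Adj Y (vmap u) (vmap v)
open Homomorphism

-- If H has an edge colouring with no colours, H and every X mapping to H
-- are edgeless, and one colour is a total colouring of X.
edgeless-colouring : ∀ {X H} → Homomorphism X H → EdgeColouring H 0 → TotalColouring X 1
edgeless-colouring {X} π eH = record
  { vcol           = λ _ → zero
  ; ecol           = λ _ _ e → ⊥-elim (no-edge e)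
  ; ecol-sym       = λ _ _ e _ → ⊥-elim (no-edge e)
  ; adj-vertices   = λ _ _ e _ → no-edge e
  ; incident-edges = λ _ _ _ e _ _ _ → no-edge e
  ; vertex-edge    = λ _ _ e _ → no-edge e }
  where
  no-edge : ∀ {p q} → Adj X p q → ⊥
  no-edge e with EdgeColouring.colour eH _ _ (preserves π e)
  ... | ()

-- Colour a vertex of X like its image in B; colour an edge whose
-- π-image has H-colour 0 like its φ-image in the total colouring of B, and an
-- edge whose π-image has H-colour i + 1 by the pair (i , colour of its φ-image in
-- the edge colouring of B), drawn from d * b further colours.
module Lift {X B H : Graph} (φ : Homomorphism X B) (π : Homomorphism X H)
            (separating : ∀ {p q} → vmap π p ≡ vmap π q → vmap φ p ≡ vmap φ q → p ≡ q)
            {a b d : ℕ} (cB : TotalColouring B a) (eB : EdgeColouring B b)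
            (eH : EdgeColouring H (suc d)) where

  private
    module cB = TotalColouring cB
    module eB = EdgeColouring eB
    module eH = EdgeColouring eH

  old : Fin a → Fin (a + d * b)
  old x = x ↑ˡ (d * b)

  new : Fin d → Fin b → Fin (a + d * b)
  new i y = a ↑ʳ combine i y

  old≢new : ∀ {x i y} → old x ≢ new i y
  old≢new {x} {i} {y} eq with trans (sym (splitAt-↑ˡ a x (d * b)))
                                    (trans (cong (splitAt a) eq) (splitAt-↑ʳ a (d * b) (combine i y)))
  ... | ()

  pick : Fin (suc d) → Fin a → Fin b → Fin (a + d * b)
  pick zero    x _ = old x
  pick (suc i) _ y = new i y

  pick-distinct : ∀ c c′ {x x′ y y′} → (c ≡ c′ → x ≢ x′ × y ≢ y′) → pick c x y ≢ pick c′ x′ y′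
  pick-distinct zero    zero     distinct eq = proj₁ (distinct refl) (↑ˡ-injective (d * b) _ _ eq)
  pick-distinct zero    (suc i′) distinct eq = old≢new eq
  pick-distinct (suc i) zero     distinct eq = old≢new (sym eq)
  pick-distinct (suc i) (suc i′) distinct eq with combine-injective i _ i′ _ (↑ʳ-injective a _ _ eq)
  ... | refl , y≡y′ = proj₂ (distinct refl) y≡y′

  pick-old : ∀ c {x y z} → x ≢ z → pick c x y ≢ old z
  pick-old zero    x≢z eq = x≢z (↑ˡ-injective (d * b) _ _ eq)
  pick-old (suc i) _   eq = old≢new (sym eq)

  lifted : TotalColouring X (a + d * b)
  lifted = record
    { vcol           = vcol
    ; ecol           = ecol
    ; ecol-sym       = λ p q e e′ →
        cong₂ (λ c (x , y) → pick c x y) (eH.colour-sym _ _ _ _) (cong₂ _,_ (cB.ecol-sym _ _ _ _) (eB.colour-sym _ _ _ _))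
    ; adj-vertices   = λ p q e → cB.adj-vertices _ _ (preserves φ e) ∘ ↑ˡ-injective (d * b) _ _
    ; incident-edges = incident
    ; vertex-edge    = λ p q e eq → pick-old (colourH e) (cB.vertex-edge _ _ (preserves φ e) ∘ sym) (sym eq) }
    where
    vcol : Fin (order X) → Fin (a + d * b)
    vcol p = old (cB.vcol (vmap φ p))
    colourH : ∀ {p q} → Adj X p q → Fin (suc d)
    colourH e = eH.colour _ _ (preserves π e)
    ecol : ∀ p q → Adj X p q → Fin (a + d * b)
    ecol p q e = pick (colourH e) (cB.ecol _ _ (preserves φ e)) (eB.colour _ _ (preserves φ e))
    -- Edges pq, pr with the same H-colour have π q ≡ π r, hence φ q ≢ φ r.
    incident : ∀ p q r (e : Adj X p q) (e′ : Adj X p r) → q ≢ r → ecol p q e ≢ ecol p r e′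
    incident p q r e e′ q≢r = pick-distinct (colourH e) (colourH e′) λ same →
      let φq≢φr : vmap φ q ≢ vmap φ r
          φq≢φr φq≡φr = q≢r (separating (sameπ same) φq≡φr)
      in cB.incident-edges _ _ _ _ _ φq≢φr , eB.proper _ _ _ _ _ φq≢φr
      where
      sameπ : colourH e ≡ colourH e′ → vmap π q ≡ vmap π r
      sameπ same with vmap π q ≟ᶠ vmap π r
      ... | yes πq≡πr = πq≡πr
      ... | no  πq≢πr = ⊥-elim (eH.proper _ _ _ _ _ πq≢πr same)

lift-colouring : ∀ {X B H} (φ : Homomorphism X B) (π : Homomorphism X H) →
                 (∀ {p q} → vmap π p ≡ vmap π q → vmap φ p ≡ vmap φ q → p ≡ q) →
                 ∀ {b d} → TotalColouring B (suc b) → EdgeColouring B b → EdgeColouring H d →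
                 TotalColouring X (suc (d * b))
lift-colouring φ π separating {d = zero}  cB eB eH = edgeless-colouring π eH
lift-colouring φ π separating {d = suc d} cB eB eH = Lift.lifted φ π separating cB eB eH

coords : ∀ G H → Fin (order (G ×ᴰ H)) → Fin (order G) × Fin (order H)
coords G H = remQuot {order G} (order H)

×ᴰ-adj : ∀ G H {x y} → Adj (G ×ᴰ H) x y →
         Adj G (proj₁ (coords G H x)) (proj₁ (coords G H y)) ×
         Adj H (proj₂ (coords G H x)) (proj₂ (coords G H y))
×ᴰ-adj G H = Equivalence.to T-∧

×ᴰ-adj-combine : ∀ G H {u u′ v v′} → Adj G u u′ → Adj H v v′ →
                 Adj (G ×ᴰ H) (combine u v) (combine u′ v′)
×ᴰ-adj-combine G H {u} {u′} {v} {v′} uu′ vv′ =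
  subst₂ (λ x y → T (adj G (proj₁ x) (proj₁ y) ∧ adj H (proj₂ x) (proj₂ y)))
         (sym (remQuot-combine u v)) (sym (remQuot-combine u′ v′)) (Equivalence.from T-∧ (uu′ , vv′))

degree-×ᴰ : ∀ G H u v → degree G u * degree H v ≤ degree (G ×ᴰ H) (combine u v)
degree-×ᴰ G H u v =
  subst₂ _≤_ (sym (cong₂ _*_ (degree-count G u) (degree-count H v)))
             (sym (degree-count (G ×ᴰ H) (combine u v)))
    (count-product (adj G u) (adj H v) (adj (G ×ᴰ H) (combine u v)) (λ _ _ → ×ᴰ-adj-combine G H))

K₂-other : ∀ {s t r : Fin 2} → s ≢ r → t ≢ r → s ≡ t
K₂-other {zero}     {zero}     _   _   = refl
K₂-other {suc zero} {suc zero} _   _   = refl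
K₂-other {zero}     {suc zero} {zero}     s≢r _   = ⊥-elim (s≢r refl)
K₂-other {zero}     {suc zero} {suc zero} _   t≢r = ⊥-elim (t≢r refl)
K₂-other {suc zero} {zero}     {zero}     _   t≢r = ⊥-elim (t≢r refl)
K₂-other {suc zero} {zero}     {suc zero} s≢r _   = ⊥-elim (s≢r refl)

K₂-adj : ∀ {s t : Fin 2} → s ≢ t → Adj K₂ s t
K₂-adj {s} {t} s≢t with s ≟ᶠ t
... | yes s≡t = s≢t s≡t
... | no  _   = tt

K₂-adj⁻¹ : ∀ {s t : Fin 2} → Adj K₂ s t → s ≢ t
K₂-adj⁻¹ {s} {t} st s≡t with s ≟ᶠ t
... | yes _   = st
... | no  s≢t = s≢t s≡t

-- A vertex of G ×ᴰ K₂ has at most the degree of its G-coordinate: its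
-- neighbours are determined by their G-coordinates.
degree-×K₂ : ∀ G x → degree (G ×ᴰ K₂) x ≤ degree G (proj₁ (coords G K₂ x))
degree-×K₂ G x =
  subst₂ _≤_ (sym (degree-count (G ×ᴰ K₂) x)) (sym (degree-count G (proj₁ (coords G K₂ x))))
    (count-mono (adj (G ×ᴰ K₂) x) (adj G (proj₁ (coords G K₂ x))) (proj₁ ∘ coords G K₂)
      (λ _ xy → proj₁ (×ᴰ-adj G K₂ xy)) determined)
  where
  determined : ∀ {y y′} → Adj (G ×ᴰ K₂) x y → Adj (G ×ᴰ K₂) x y′ →
               proj₁ (coords G K₂ y) ≡ proj₁ (coords G K₂ y′) → y ≡ y′
  determined xy xy′ same = remQuot-injective 2 (cong₂ _,_ same
    (K₂-other (K₂-adj⁻¹ (proj₂ (×ᴰ-adj G K₂ xy)) ∘ sym) (K₂-adj⁻¹ (proj₂ (×ᴰ-adj G K₂ xy′)) ∘ sym)))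

maxDegree-×ᴰ : ∀ G H → maxDegree H * maxDegree (G ×ᴰ K₂) ≤ maxDegree (G ×ᴰ H)
maxDegree-×ᴰ G H with maxDegree-attained H | maxDegree-attained (G ×ᴰ K₂)
... | inj₁ ΔH≡0 | _ rewrite ΔH≡0 = z≤n
... | inj₂ _ | inj₁ ΔB≡0 rewrite ΔB≡0 | *-zeroʳ (maxDegree H) = z≤n
... | inj₂ (v , dv) | inj₂ (x , dx) = begin
  maxDegree H * maxDegree (G ×ᴰ K₂) ≡⟨ sym (cong₂ _*_ dv dx) ⟩
  degree H v * degree (G ×ᴰ K₂) x   ≤⟨ *-monoʳ-≤ (degree H v) (degree-×K₂ G x) ⟩
  degree H v * degree G u           ≡⟨ *-comm (degree H v) (degree G u) ⟩
  degree G u * degree H v           ≤⟨ degree-×ᴰ G H u v ⟩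
  degree (G ×ᴰ H) (combine u v)     ≤⟨ degree≤maxDegree (G ×ᴰ H) (combine u v) ⟩
  maxDegree (G ×ᴰ H)                ∎
  where
  open ≤-Reasoning
  u = proj₁ (coords G K₂ x)

bit : Bool → Fin 2
bit false = zero
bit true  = suc zero

unbit : Fin 2 → Bool
unbit zero    = false
unbit (suc _) = true

unbit-injective : ∀ {s t} → unbit s ≡ unbit t → s ≡ t
unbit-injective {zero}     {zero}     _ = refl
unbit-injective {suc zero} {suc zero} _ = refl

×K₂-bipartite : ∀ G → Bipartite (G ×ᴰ K₂)
×K₂-bipartite G = unbit ∘ proj₂ ∘ coords G K₂ ,
  λ x y xy → K₂-adj⁻¹ (proj₂ (×ᴰ-adj G K₂ xy)) ∘ unbit-injective

project : ∀ G H → Homomorphism (G ×ᴰ H) H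
project G H = record { vmap = proj₂ ∘ coords G H ; preserves = proj₂ ∘ ×ᴰ-adj G H }

fold : ∀ G H → Bipartite H → Homomorphism (G ×ᴰ H) (G ×ᴰ K₂)
fold G H (side , bipartite) = record
  { vmap      = λ x → combine (proj₁ (coords G H x)) (bit (side (proj₂ (coords G H x))))
  ; preserves = λ xy → ×ᴰ-adj-combine G K₂ (proj₁ (×ᴰ-adj G H xy))
                         (K₂-adj (bipartite _ _ (proj₂ (×ᴰ-adj G H xy)) ∘ bit-injective)) }
  where
  bit-injective : ∀ {s t} → bit s ≡ bit t → s ≡ t
  bit-injective {false} {false} _ = refl
  bit-injective {true}  {true}  _ = refl

-- The G-coordinate, recorded by the fold, and the H-coordinate determine a vertex.
fold-project-separating : ∀ G H (bip : Bipartite H) {p q} →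
  vmap (project G H) p ≡ vmap (project G H) q →
  vmap (fold G H bip) p ≡ vmap (fold G H bip) q → p ≡ q
fold-project-separating G H _ sameH sameB =
  remQuot-injective {order G} (order H)
    (cong₂ _,_ (proj₁ (combine-injective {order G} {2} _ _ _ _ sameB)) sameH)

theorem1 : (G : Graph) → TypeI (G ×ᴰ K₂) →
    (H : Graph) → order H ≥ 1 → Bipartite H → TypeI (G ×ᴰ H)
theorem1 G typeI-B H H≥1 bipH =
  more-colours X (s≤s (maxDegree-×ᴰ G H)) colouring , λ _ → maxDegree<colours X (combine u₀ v₀)
  where
  B = G ×ᴰ K₂
  X = G ×ᴰ H
  colouring : TotalColouring X (suc (maxDegree H * maxDegree B))
  colouring = lift-colouring (fold G H bipH) (project G H) (fold-project-separating G H bipH)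
                (proj₁ typeI-B) (kőnig B (×K₂-bipartite G)) (kőnig H bipH)
  -- a vertex of X, which exists since B is type I and H is nonempty
  u₀ : Fin (order G)
  u₀ = proj₁ (coords G K₂ (typeI-vertex B typeI-B))
  v₀ : Fin (order H)
  v₀ = fromℕ< H≥1
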